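{- Let $\mathcal{P}\subset\mathbb{R}_{\ge0}^n$ be an anti-blocking lattice polytope of dimension $n$, $A=\mathcal{P}\cap\mathbb{Z}^n$, let $\Lambda=((\mathbf{a}_1,\varepsilon_1),\dots,(\mathbf{a}_r,\varepsilon_r))$ with $\mathbf{a}_j\in A$, $\varepsilon_j\in\{ -1,1\}^n$, and for some $1\le p\le r-1$ let $\Lambda'$ be the ordered list obtained from $\Lambda$ by exchanging the entries in positions $p$ and $p+1$. Suppose $\omega(\Lambda)$ ($=\omega(\Lambda')$) is nonnegative. Then $m(\nu(\Lambda))-m(\nu(\Lambda'))$ is a monomial multiple of a quadratic binomial in $I_{\mathcal{P}}$, i.e., it equals $M\cdot(x_{\mathbf{c}}x_{\mathbf{d}}-x_{\mathbf{c}'}x_{\mathbf{d}'})$ for some monomial $M\in K[x_{\mathbf{a}}:\mathbf{a}\in A]$ and some $\mathbf{c},\mathbf{d},\mathbf{c}',\mathbf{d}'\in A$ with $x_{\mathbf{c}}x_{\mathbf{d}}-x_{\mathbf{c}'}x_{\mathbf{d}'}\in I_{\mathcal{P}}$.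
   Context: A lattice polytope $\mathcal{P}\subset\mathbb{R}_{\ge0}^n$ of dimension $n$ with integer vertices is anti-blocking if for every $\mathbf{y}\in\mathcal{P}$ and $\mathbf{x}\in\mathbb{R}^n$ with $0\le x_i\le y_i$ for all $i$, $\mathbf{x}\in\mathcal{P}$. $K$ is a field; the toric ideal $I_{\mathcal{P}}$ is the kernel of $K[x_{\mathbf{a}}:\mathbf{a}\in A]\to K[t_1^{\pm1},\dots,t_n^{\pm1},s]$, $x_{\mathbf{a}}\mapsto t_1^{a_1}\cdots t_n^{a_n}s$. For $\varepsilon\in\{ -1,1\}^n$, $\varepsilon\mathbf{x}:=(\varepsilon_1x_1,\dots,\varepsilon_nx_n)$. For an ordered list $\Lambda=((\mathbf{a}_1,\varepsilon_1),\dots,(\mathbf{a}_r,\varepsilon_r))$ with $\mathbf{a}_j=(a_{j,1},\dots,a_{j,n})\in A$, $\varepsilon_j=(\varepsilon_{j,1},\dots,\varepsilon_{j,n})\in\{ -1,1\}^n$, set $\omega(\Lambda)=(\omega_1(\Lambda),\dots,\omega_n(\Lambda)):=\sum_j\varepsilon_j\mathbf{a}_j$. When $\omega(\Lambda)\ge0$: for $k\in[n]$, $P_k(\Lambda)$ is the ordered list $(1,\dots,1,2,\dots,2,\dots,r,\dots,r)$ in which $j$ appears $a_{j,k}$ times if $\varepsilon_{j,k}=1$ and $0$ times if $\varepsilon_{j,k}=-1$; $c_{j,k}(\Lambda)$ is the number of times $j$ appears among the first $\omega_k(\Lambda)$ entries of $P_k(\Lambda)$; $\mathbf{c}_j(\Lambda)=(c_{j,1}(\Lambda),\dots,c_{j,n}(\Lambda))$,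 which lies in $A$; $\nu(\Lambda)=(\mathbf{c}_1(\Lambda),\dots,\mathbf{c}_r(\Lambda))$ and $m(\nu(\Lambda))=x_{\mathbf{c}_1(\Lambda)}\cdots x_{\mathbf{c}_r(\Lambda)}\in K[x_{\mathbf{a}}:\mathbf{a}\in A]$. -}

module Defs where

open import Level using (Level; _⊔_)
open import Data.Bool using (Bool; true; false; if_then_else_; _∧_)
open import Data.Nat as ℕ using (ℕ; zero; suc; _≤_)
open import Data.Integer as ℤ using (ℤ; +_; ∣_∣)
open import Data.Sign using (Sign)
open import Data.Fin using (Fin)
open import Data.Vec as Vec using (Vec; lookup; tabulate)
open import Data.Vec.Properties using (≡-dec)
open import Data.List as List using (List; []; _∷_; _++_; map; foldr; length; replicate; concat; take; zip; upTo)
open import Data.Product using (_×_; _,_; ∃)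
open import Relation.Nullary using (¬_; does)
open import Relation.Binary.PropositionalEquality using (_≡_)
open import Algebra.Bundles using (CommutativeRing)

record Field (c ℓ : Level) : Set (Level.suc (c ⊔ ℓ)) where
  field
    commutativeRing : CommutativeRing c ℓ
  open CommutativeRing commutativeRing public
  field
    0≉1 : ¬ (0# ≈ 1#)
    inverse : ∀ x → ¬ (x ≈ 0#) → ∃ λ y → (x * y) ≈ 1#

-- Lattice points.  Points of ℤⁿ ∩ ℝⁿ_{≥0} are vectors of naturals.

Point : ℕ → Set
Point n = Vec ℕ n

_≤ᵥ_ : ∀ {n} → Point n → Point n → Set
_≤ᵥ_ {n} x y = (i : Fin n) → lookup x i ≤ lookup y i

unit : ∀ {n} → Fin n → Point n
unit i = tabulate λ k → if does (k Data.Fin.≟ i) then 1 else 0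

-- A = P ∩ ℤⁿ for an n-dimensional anti-blocking lattice polytope
-- P ⊂ ℝⁿ_{≥0}: P = conv A, and the conditions on
-- P are equivalent to the following conditions on the set A ⊆ ℕⁿ.
record AntiBlockingLatticePoints (n : ℕ) (A : Point n → Set) : Set where
  field
    nonempty   : ∃ λ a → A a
    bounded    : ∃ λ B → ∀ a → A a → (i : Fin n) → lookup a i ≤ B
    downClosed : ∀ x y → A y → x ≤ᵥ y → A x
    fullDim    : (i : Fin n) → A (unit i)

Entry : ℕ → Set
Entry n = Point n × Vec Sign n

signed : Sign → ℕ → ℤ
signed Sign.+ a = + a
signed Sign.- a = ℤ.- (+ a)

ω : ∀ {n} → List (Entry n) → Fin n → ℤ
ω Λ k = foldr (λ { (a , ε) acc → signed (lookup ε k) (lookup a k) ℤ.+ acc }) (+ 0) Λ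

-- positions 0,…,r-1 paired with the entries (positions are 0-based here)
indexed : ∀ {A : Set} → List A → List (ℕ × A)
indexed xs = zip (upTo (length xs)) xs

posMult : Sign → ℕ → ℕ
posMult Sign.+ a = a
posMult Sign.- a = 0

P : ∀ {n} → List (Entry n) → Fin n → List ℕ
P Λ k = concat (map (λ { (j , (a , ε)) → replicate (posMult (lookup ε k) (lookup a k)) j }) (indexed Λ))

occ : ℕ → List ℕ → ℕ
occ j [] = 0
occ j (x ∷ xs) = if does (x ℕ.≟ j) then suc (occ j xs) else occ j xs

-- c_{j,k}(Λ): occurrences of j among the first ω_k(Λ) entries of P_k(Λ)
-- (used only when ω(Λ) ≥ 0, where ω_k(Λ) = ∣ ω_k(Λ) ∣)
c : ∀ {n} → List (Entry n) → ℕ → Fin n → ℕ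
c Λ j k = occ j (take ∣ ω Λ k ∣ (P Λ k))

cvec : ∀ {n} → List (Entry n) → ℕ → Point n
cvec Λ j = tabulate (c Λ j)

-- ν(Λ) = (c₁(Λ),…,c_r(Λ)), read as the monomial m(ν(Λ))
ν : ∀ {n} → List (Entry n) → List (Point n)
ν Λ = map (cvec Λ) (upTo (length Λ))

-- Polynomials in K[x_a : a ∈ ℕⁿ] as finite formal sums of terms
-- (coefficient , monomial); a monomial is a list of variables x_a
-- (a commutative product, so compared as a multiset).

Monomial : ℕ → Set
Monomial n = List (Point n)

countPt : ∀ {n} → Point n → Monomial n → ℕ
countPt a [] = 0
countPt a (b ∷ μ) = if does (≡-dec ℕ._≟_ b a) then suc (countPt a μ) else countPt a μ

allB : ∀ {A : Set} → (A → Bool) → List A → Bool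
allB p [] = true
allB p (x ∷ xs) = p x ∧ allB p xs

sameMonomial : ∀ {n} → Monomial n → Monomial n → Bool
sameMonomial μ μ' = allB (λ a → does (countPt a μ ℕ.≟ countPt a μ')) (μ ++ μ')

-- sum of the exponent vectors: x_{a₁}⋯x_{a_m} ↦ t^{a₁+⋯+a_m} s^m
sumPts : ∀ {n} → Monomial n → Point n
sumPts {n} [] = Vec.replicate n 0
sumPts (a ∷ μ) = Vec.zipWith ℕ._+_ a (sumPts μ)

module Poly {c ℓ} (K : Field c ℓ) (n : ℕ) where
  open Field K

  Polynomial : Set c
  Polynomial = List (Carrier × Monomial n)

  coeff : Polynomial → Monomial n → Carrier
  coeff f μ = foldr (λ { (κ , μ') acc → if sameMonomial μ' μ then κ + acc else acc }) 0# f

  _≈ₚ_ : Polynomial → Polynomial → Set ℓ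
  f ≈ₚ g = ∀ μ → coeff f μ ≈ coeff g μ

  mono : Monomial n → Polynomial
  mono μ = (1# , μ) ∷ []

  _−ₚ_ : Polynomial → Polynomial → Polynomial
  f −ₚ g = f ++ map (λ { (κ , μ) → (- κ , μ) }) g

  _·ₘ_ : Monomial n → Polynomial → Polynomial
  M ·ₘ f = map (λ { (κ , μ) → (κ , M ++ μ) }) f

  binom : Point n → Point n → Point n → Point n → Polynomial
  binom c d c' d' = mono (c ∷ d ∷ []) −ₚ mono (c' ∷ d' ∷ [])

  -- coefficient of t^e s^m in the image of f under x_a ↦ t^a s
  imgCoeff : Polynomial → Point n → ℕ → Carrier
  imgCoeff f e m = foldr (λ { (κ , μ) acc →
      if does (≡-dec ℕ._≟_ (sumPts μ) e) ∧ does (length μ ℕ.≟ m) then κ + acc else acc }) 0# f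

  -- f ∈ I_P : the image of f is zero (all its coefficients vanish)
  InToric : Polynomial → Set ℓ
  InToric f = ∀ e m → imgCoeff f e m ≈ 0#

{-# OPTIONS --safe #-}
module Submission where

-- Label the entries of Λ by their positions, write p = |pre| and let
-- w_k(a, ε) be a_k if ε_k = 1 and 0 otherwise.  Then
--   P_k(Λ)  = X ++ (w_k(e₁) copies of p ++ w_k(e₂) copies of p+1) ++ Y,
--   P_k(Λ') = X ++ (w_k(e₂) copies of p ++ w_k(e₁) copies of p+1) ++ Y,
-- where X and Y only contain the other labels and the two middle blocks
-- have the same length.  Since ω(Λ) = ω(Λ'), the prefixes of length ω_k
-- contain every label j ∉ {p, p+1} equally often, and the labels p and p+1
-- together equally often (as many times as the prefix overlaps the middle
-- block).  So ν(Λ) and ν(Λ') agree outside the positions p, p+1, and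
-- c_p + c_{p+1} = c'_p + c'_{p+1}, which is exactly the toric relation.
-- Finally c_{j,k} ≤ a_{j,k}, so every c_j lies in the down-closed set A.

open import Defs
open import Level using (Level)
open import Function using (_∘_; id)
open import Function.Definitions using (Injective)
open import Data.Bool using (Bool; true; false; _∧_; if_then_else_)
open import Data.Sum using (_⊎_; inj₁; inj₂)
open import Data.Product using (_×_; _,_; proj₁; proj₂; Σ-syntax)
open import Data.Sign using (Sign)
open import Data.Nat as ℕ using (ℕ; zero; suc; _+_; _∸_; _⊓_; _<_; z≤n; s≤s; z<s; s<s)
import Data.Nat.Properties as ℕP
open import Data.Integer as ℤ using (+_; ∣_∣; _≤_)
import Data.Integer.Properties as ℤP
import Algebra.Properties.CommutativeSemigroup ℤP.+-commutativeSemigroup as ℤ+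
open import Data.Fin as Fin using (Fin)
open import Data.Vec as Vec using (lookup; tabulate)
import Data.Vec.Properties as VecP
open import Data.List
  using (List; []; _∷_; _++_; map; concat; length; replicate; take; zip; filter; applyUpTo; upTo)
import Data.List.Properties as ListP
open import Data.List.Relation.Unary.All as All using (All; []; _∷_)
import Data.List.Relation.Unary.All.Properties as AllP
open import Data.List.Relation.Binary.Permutation.Propositional as ↭
  using (_↭_; module PermutationReasoning)
import Data.List.Relation.Binary.Permutation.Propositional.Properties as ↭P
open import Relation.Nullary using (does; yes; no)
open import Relation.Nullary.Decidable using (dec-true; dec-false)
open import Relation.Binary.PropositionalEquality

open AntiBlockingLatticePoints using (nonempty; downClosed)

take-++ : ∀ {A : Set} m (xs ys : List A) → take m (xs ++ ys) ≡ take m xs ++ take (m ∸ length xs) ys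
take-++ zero    []       ys = refl
take-++ zero    (x ∷ xs) ys = refl
take-++ (suc m) []       ys = refl
take-++ (suc m) (x ∷ xs) ys = cong (x ∷_) (take-++ m xs ys)

applyUpTo-+ : ∀ {A : Set} (f : ℕ → A) m n → applyUpTo f (m + n) ≡ applyUpTo f m ++ applyUpTo (λ i → f (m + i)) n
applyUpTo-+ f zero    n = refl
applyUpTo-+ f (suc m) n = cong (f 0 ∷_) (applyUpTo-+ (f ∘ suc) m n)

occ-∷-≡ : ∀ j xs → occ j (j ∷ xs) ≡ suc (occ j xs)
occ-∷-≡ j xs rewrite dec-true (j ℕ.≟ j) refl = refl

occ-∷-≢ : ∀ {j x} xs → x ≢ j → occ j (x ∷ xs) ≡ occ j xs
occ-∷-≢ {j} {x} xs x≢j rewrite dec-false (x ℕ.≟ j) x≢j = refl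

occ-++ : ∀ j (xs ys : List ℕ) → occ j (xs ++ ys) ≡ occ j xs + occ j ys
occ-++ j []       ys = refl
occ-++ j (x ∷ xs) ys with x ℕ.≟ j
... | yes refl rewrite occ-∷-≡ j (xs ++ ys) | occ-∷-≡ j xs = cong suc (occ-++ j xs ys)
... | no x≢j   rewrite occ-∷-≢ (xs ++ ys) x≢j | occ-∷-≢ xs x≢j = occ-++ j xs ys

occ-≡0 : ∀ {j xs} → All (_≢ j) xs → occ j xs ≡ 0
occ-≡0 []                         = refl
occ-≡0 {xs = _ ∷ xs} (x≢j ∷ xs∌j) = trans (occ-∷-≢ xs x≢j) (occ-≡0 xs∌j)

occ-replicate : ∀ j α → occ j (replicate α j) ≡ α
occ-replicate j zero    = refl
occ-replicate j (suc α) = trans (occ-∷-≡ j (replicate α j)) (cong suc (occ-replicate j α))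

occ-take-≤ : ∀ j m xs → occ j (take m xs) ℕ.≤ occ j xs
occ-take-≤ j zero    xs       = z≤n
occ-take-≤ j (suc m) []       = z≤n
occ-take-≤ j (suc m) (x ∷ xs) with x ℕ.≟ j
... | yes refl rewrite occ-∷-≡ j (take m xs) | occ-∷-≡ j xs = s≤s (occ-take-≤ j m xs)
... | no x≢j   rewrite occ-∷-≢ (take m xs) x≢j | occ-∷-≢ xs x≢j = occ-take-≤ j m xs

occ+occ≡length : ∀ {a b} → a ≢ b → ∀ {xs} → All (λ x → x ≡ a ⊎ x ≡ b) xs → occ a xs + occ b xs ≡ length xs
occ+occ≡length a≢b []                          = refl
occ+occ≡length {a} {b} a≢b {_ ∷ xs} (inj₁ refl ∷ h)
  rewrite occ-∷-≡ a xs | occ-∷-≢ xs a≢b = cong suc (occ+occ≡length a≢b h)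
occ+occ≡length {a} {b} a≢b {_ ∷ xs} (inj₂ refl ∷ h)
  rewrite occ-∷-≢ xs (a≢b ∘ sym) | occ-∷-≡ b xs = trans (ℕP.+-suc _ _) (cong suc (occ+occ≡length a≢b h))

occ-take-++ : ∀ j m (xs ys : List ℕ) → occ j (take m (xs ++ ys)) ≡ occ j (take m xs) + occ j (take (m ∸ length xs) ys)
occ-take-++ j m xs ys = trans (cong (occ j) (take-++ m xs ys)) (occ-++ j (take m xs) _)

occ-take-++-∌ˡ : ∀ {j} m {xs} ys → All (_≢ j) xs → occ j (take m (xs ++ ys)) ≡ occ j (take (m ∸ length xs) ys)
occ-take-++-∌ˡ {j} m {xs} ys xs∌j =
  trans (occ-take-++ j m xs ys) (cong (λ u → u + occ j (take (m ∸ length xs) ys)) (occ-≡0 (AllP.take⁺ m xs∌j)))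

occ-take-++-∌ʳ : ∀ {j} m xs {ys} → All (_≢ j) ys → occ j (take m (xs ++ ys)) ≡ occ j (take m xs)
occ-take-++-∌ʳ {j} m xs {ys} ys∌j = begin
  occ j (take m (xs ++ ys))                                  ≡⟨ occ-take-++ j m xs ys ⟩
  occ j (take m xs) + occ j (take (m ∸ length xs) ys)        ≡⟨ cong (λ u → occ j (take m xs) + u) (occ-≡0 (AllP.take⁺ (m ∸ length xs) ys∌j)) ⟩
  occ j (take m xs) + 0                                      ≡⟨ ℕP.+-identityʳ _ ⟩
  occ j (take m xs)                                          ∎
  where open ≡-Reasoning

occ-take-outside : ∀ {j} m X {B B'} Y → length B ≡ length B' → All (_≢ j) B → All (_≢ j) B' →
                   occ j (take m (X ++ B ++ Y)) ≡ occ j (take m (X ++ B' ++ Y))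
occ-take-outside {j} m X {B} {B'} Y |B|≡|B'| B∌j B'∌j = begin
  occ j (take m (X ++ B ++ Y))                          ≡⟨ occ-take-++ j m X (B ++ Y) ⟩
  occ j (take m X) + occ j (take t (B ++ Y))            ≡⟨ cong (λ u → occ j (take m X) + u) (occ-take-++-∌ˡ t Y B∌j) ⟩
  occ j (take m X) + occ j (take (t ∸ length B) Y)      ≡⟨ cong (λ l → occ j (take m X) + occ j (take (t ∸ l) Y)) |B|≡|B'| ⟩
  occ j (take m X) + occ j (take (t ∸ length B') Y)     ≡⟨ cong (λ u → occ j (take m X) + u) (occ-take-++-∌ˡ t Y B'∌j) ⟨
  occ j (take m X) + occ j (take t (B' ++ Y))           ≡⟨ occ-take-++ j m X (B' ++ Y) ⟨
  occ j (take m (X ++ B' ++ Y))                         ∎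
  where
  open ≡-Reasoning
  t = m ∸ length X

occ-take-pair : ∀ {a b} → a ≢ b → ∀ m {X B Y} →
                All (λ x → x ≢ a × x ≢ b) X → All (λ x → x ≢ a × x ≢ b) Y → All (λ x → x ≡ a ⊎ x ≡ b) B →
                occ a (take m (X ++ B ++ Y)) + occ b (take m (X ++ B ++ Y)) ≡ (m ∸ length X) ⊓ length B
occ-take-pair {a} {b} a≢b m {X} {B} {Y} X-away Y-away B⊆ab = begin
  occ a (take m (X ++ B ++ Y)) + occ b (take m (X ++ B ++ Y))  ≡⟨ cong₂ _+_ (only-B proj₁) (only-B proj₂) ⟩
  occ a (take t B) + occ b (take t B)                          ≡⟨ occ+occ≡length a≢b (AllP.take⁺ t B⊆ab) ⟩
  length (take t B)                                            ≡⟨ ListP.length-take t B ⟩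
  t ⊓ length B                                                 ∎
  where
  open ≡-Reasoning
  t = m ∸ length X
  only-B : ∀ {j} → (∀ {x} → x ≢ a × x ≢ b → x ≢ j) → occ j (take m (X ++ B ++ Y)) ≡ occ j (take t B)
  only-B away = trans (occ-take-++-∌ˡ m (B ++ Y) (All.map away X-away))
                      (occ-take-++-∌ʳ t B (All.map away Y-away))

module _ {n : ℕ} (k : Fin n) where

  weight : Entry n → ℕ
  weight (a , ε) = posMult (lookup ε k) (lookup a k)

  -- P_k with the block of the i-th entry labelled f i instead of i.
  blocks : (ℕ → ℕ) → List (Entry n) → List ℕ
  blocks f []      = []
  blocks f (e ∷ Λ) = replicate (weight e) (f 0) ++ blocks (f ∘ suc) Λ

  P≡blocks : ∀ Λ → P Λ k ≡ blocks id Λ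
  P≡blocks Λ = go _ (λ _ _ → refl) id Λ
    where
    go : ∀ (g : ℕ × Entry n → List ℕ) → (∀ j e → g (j , e) ≡ replicate (weight e) j) →
         ∀ f Λ → concat (map g (zip (applyUpTo f (length Λ)) Λ)) ≡ blocks f Λ
    go g g-block f []      = refl
    go g g-block f (e ∷ Λ) = cong₂ _++_ (g-block (f 0) e) (go g g-block (f ∘ suc) Λ)

  blocks-++ : ∀ f xs ys → blocks f (xs ++ ys) ≡ blocks f xs ++ blocks (λ i → f (length xs + i)) ys
  blocks-++ f []       ys = refl
  blocks-++ f (e ∷ xs) ys = trans (cong (replicate (weight e) (f 0) ++_) (blocks-++ (f ∘ suc) xs ys))
                                  (sym (ListP.++-assoc (replicate (weight e) (f 0)) _ _))

  blocks-labels : ∀ {Q : ℕ → Set} f Λ → (∀ {i} → i < length Λ → Q (f i)) → All Q (blocks f Λ)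
  blocks-labels f []      Q-f = []
  blocks-labels f (e ∷ Λ) Q-f = AllP.++⁺ (AllP.replicate⁺ (weight e) (Q-f z<s)) (blocks-labels (f ∘ suc) Λ (Q-f ∘ s<s))

posMult≤ : ∀ s m → posMult s m ℕ.≤ m
posMult≤ Sign.+ m = ℕP.≤-refl
posMult≤ Sign.- m = z≤n

occ-blocks-dominated : ∀ {n} {A : Point n → Set} {a₀} → A a₀ → ∀ {f} → Injective _≡_ _≡_ f →
                       ∀ {Λ} → All (A ∘ proj₁) Λ →
                       ∀ j → Σ[ a ∈ Point n ] (A a × ∀ k → occ j (blocks k f Λ) ℕ.≤ lookup a k)
occ-blocks-dominated A₀ f-inj [] j = _ , A₀ , λ _ → z≤n
occ-blocks-dominated A₀ {f} f-inj {(a , ε) ∷ Λ} (Aa ∷ AΛ) j with f 0 ℕ.≟ j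
... | yes refl = a , Aa , λ k → ℕP.≤-trans (ℕP.≤-reflexive (head-only k)) (posMult≤ (lookup ε k) (lookup a k))
  where
  head-only : ∀ k → occ (f 0) (blocks k f ((a , ε) ∷ Λ)) ≡ weight k (a , ε)
  head-only k = trans (occ-++ (f 0) (replicate (weight k (a , ε)) (f 0)) _)
                      (trans (cong₂ _+_ (occ-replicate (f 0) _)
                                        (occ-≡0 (blocks-labels k (f ∘ suc) Λ (λ _ → ℕP.1+n≢0 ∘ f-inj))))
                             (ℕP.+-identityʳ _))
... | no f0≢j with occ-blocks-dominated A₀ (ℕP.suc-injective ∘ f-inj) AΛ j
...   | b , Ab , b-dominates = b , Ab , λ k → ℕP.≤-trans (ℕP.≤-reflexive (tail-only k)) (b-dominates k)
  where
  tail-only : ∀ k → occ j (blocks k f ((a , ε) ∷ Λ)) ≡ occ j (blocks k (f ∘ suc) Λ)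
  tail-only k = trans (occ-++ j (replicate (weight k (a , ε)) (f 0)) _)
                      (cong (λ u → u + _) (occ-≡0 (AllP.replicate⁺ (weight k (a , ε)) f0≢j)))

cvec∈ : ∀ {n} {A : Point n → Set} → AntiBlockingLatticePoints n A →
        ∀ {Λ} → All (A ∘ proj₁) Λ → ∀ j → A (cvec Λ j)
cvec∈ ab {Λ} AΛ j with occ-blocks-dominated (proj₂ (nonempty ab)) id AΛ j
... | a , Aa , a-dominates = downClosed ab (cvec Λ j) a Aa λ k → begin
  lookup (cvec Λ j) k               ≡⟨ VecP.lookup∘tabulate (c Λ j) k ⟩
  occ j (take ∣ ω Λ k ∣ (P Λ k))    ≤⟨ occ-take-≤ j ∣ ω Λ k ∣ (P Λ k) ⟩
  occ j (P Λ k)                     ≡⟨ cong (occ j) (P≡blocks k Λ) ⟩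
  occ j (blocks k id Λ)             ≤⟨ a-dominates k ⟩
  lookup a k                        ∎
  where open ℕP.≤-Reasoning

ω-swap : ∀ {n} (pre : List (Entry n)) e₁ e₂ post k → ω (pre ++ e₁ ∷ e₂ ∷ post) k ≡ ω (pre ++ e₂ ∷ e₁ ∷ post) k
ω-swap []              (a , ε) (a' , ε') post k =
  ℤ+.x∙yz≈y∙xz (signed (lookup ε k) (lookup a k)) (signed (lookup ε' k) (lookup a' k)) (ω post k)
ω-swap ((a , ε) ∷ pre) e₁ e₂ post k =
  cong (λ z → signed (lookup ε k) (lookup a k) ℤ.+ z) (ω-swap pre e₁ e₂ post k)

upTo-↭ : ∀ p q → upTo (p + suc (suc q)) ↭ (upTo p ++ applyUpTo (λ i → p + suc (suc i)) q) ++ p + 0 ∷ p + 1 ∷ []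
upTo-↭ p q = begin
  upTo (p + suc (suc q))            ≡⟨ applyUpTo-+ id p (suc (suc q)) ⟩
  upTo p ++ (labels ++ others)      ↭⟨ ↭P.++⁺ˡ (upTo p) (↭P.++-comm labels others) ⟩
  upTo p ++ (others ++ labels)      ≡⟨ ListP.++-assoc (upTo p) others _ ⟨
  (upTo p ++ others) ++ labels      ∎
  where
  open PermutationReasoning
  others = applyUpTo (λ i → p + suc (suc i)) q
  labels = p + 0 ∷ p + 1 ∷ []

sumPts-tabulate-pair : ∀ {n} (f g : Fin n → ℕ) → sumPts (tabulate f ∷ tabulate g ∷ []) ≡ tabulate (λ k → f k + g k)
sumPts-tabulate-pair {zero}  f g = refl
sumPts-tabulate-pair {suc n} f g = cong₂ Vec._∷_ (cong (λ z → f Fin.zero + z) (ℕP.+-identityʳ (g Fin.zero)))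
                                                  (sumPts-tabulate-pair (f ∘ Fin.suc) (g ∘ Fin.suc))

countPt≡length-filter : ∀ {n} (a : Point n) μ → countPt a μ ≡ length (filter (λ b → VecP.≡-dec ℕ._≟_ b a) μ)
countPt≡length-filter a []      = refl
countPt≡length-filter a (b ∷ μ) with does (VecP.≡-dec ℕ._≟_ b a)
... | true  = cong suc (countPt≡length-filter a μ)
... | false = countPt≡length-filter a μ

countPt-↭ : ∀ {n} {μ₁ μ₂ : Monomial n} → μ₁ ↭ μ₂ → ∀ a → countPt a μ₁ ≡ countPt a μ₂
countPt-↭ {μ₁ = μ₁} {μ₂} μ₁↭μ₂ a = begin
  countPt a μ₁                   ≡⟨ countPt≡length-filter a μ₁ ⟩
  length (filter a? μ₁)          ≡⟨ ↭P.↭-length (↭P.filter-↭ a? μ₁↭μ₂) ⟩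
  length (filter a? μ₂)          ≡⟨ countPt≡length-filter a μ₂ ⟨
  countPt a μ₂                   ∎
  where
  open ≡-Reasoning
  a? = λ b → VecP.≡-dec ℕ._≟_ b a

allB-↭ : ∀ {B : Set} (p : B → Bool) {xs ys} → xs ↭ ys → allB p xs ≡ allB p ys
allB-↭ p ↭.refl            = refl
allB-↭ p (↭.prep x xs↭ys)  = cong (p x ∧_) (allB-↭ p xs↭ys)
allB-↭ p (↭.swap x y xs↭ys) with p x | p y
... | true  | true  = allB-↭ p xs↭ys
... | true  | false = refl
... | false | true  = refl
... | false | false = refl
allB-↭ p (↭.trans xs↭ys ys↭zs) = trans (allB-↭ p xs↭ys) (allB-↭ p ys↭zs)

allB-cong : ∀ {B : Set} {p q : B → Bool} → (∀ x → p x ≡ q x) → ∀ xs → allB p xs ≡ allB q xs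
allB-cong p≗q []       = refl
allB-cong p≗q (x ∷ xs) = cong₂ _∧_ (p≗q x) (allB-cong p≗q xs)

sameMonomial-↭ : ∀ {n} {μ₁ μ₂ : Monomial n} → μ₁ ↭ μ₂ → ∀ μ → sameMonomial μ₁ μ ≡ sameMonomial μ₂ μ
sameMonomial-↭ {μ₁ = μ₁} μ₁↭μ₂ μ =
  trans (allB-cong (λ a → cong (λ m → does (m ℕ.≟ countPt a μ)) (countPt-↭ μ₁↭μ₂ a)) (μ₁ ++ μ))
        (allB-↭ _ (↭P.++⁺ʳ μ μ₁↭μ₂))

module _ {ℓc ℓ} (K : Field ℓc ℓ) (n : ℕ) where
  open Poly K n
  open Field K using (Carrier; _≈_; 0#; 1#; -_; +-cong; +-identityʳ; -‿inverseʳ; reflexive)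
    renaming (_+_ to _+ₖ_; refl to ≈-refl; trans to ≈-trans)

  -- Both coeff (mono μ −ₚ mono μ') and imgCoeff (binom c d c' d') reduce to this,
  -- with s and s' the tests for the first and the second term.
  coeff± : Bool → Bool → Carrier
  coeff± s s' = if s then 1# +ₖ rest else rest
    where rest = if s' then - 1# +ₖ 0# else 0#

  coeff±-diag : ∀ s → coeff± s s ≈ 0#
  coeff±-diag true  = ≈-trans (+-cong ≈-refl (+-identityʳ (- 1#))) (-‿inverseʳ 1#)
  coeff±-diag false = ≈-refl

  binom-toric : ∀ {c d c' d'} → sumPts (c ∷ d ∷ []) ≡ sumPts (c' ∷ d' ∷ []) → InToric (binom c d c' d')
  binom-toric {c' = c'} {d'} cd≡c'd' e m = ≈-trans (reflexive (cong (λ v → coeff± (test v) s') cd≡c'd')) (coeff±-diag s')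
    where
    test : Point n → Bool
    test v = does (VecP.≡-dec ℕ._≟_ v e) ∧ does (2 ℕ.≟ m)
    s' = test (sumPts (c' ∷ d' ∷ []))

  −ₚ-≈ₚ-·ₘbinom : ∀ {ν₁ ν₂ M c d c' d'} → ν₁ ↭ M ++ c ∷ d ∷ [] → ν₂ ↭ M ++ c' ∷ d' ∷ [] →
                  (mono ν₁ −ₚ mono ν₂) ≈ₚ (M ·ₘ binom c d c' d')
  −ₚ-≈ₚ-·ₘbinom ν₁↭ ν₂↭ μ = reflexive (cong₂ coeff± (sameMonomial-↭ ν₁↭ μ) (sameMonomial-↭ ν₂↭ μ))

module Swap {n : ℕ} (pre : List (Entry n)) (e₁ e₂ : Entry n) (post : List (Entry n)) where

  Λ Λ' : List (Entry n)
  Λ  = pre ++ e₁ ∷ e₂ ∷ post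
  Λ' = pre ++ e₂ ∷ e₁ ∷ post

  p q : ℕ
  p = length pre
  q = length post

  -- Written p + 0 and p + 1 because this is how blocks-++ and applyUpTo-+ produce them.
  i₁ i₂ : ℕ
  i₁ = p + 0
  i₂ = p + 1

  Away : ℕ → Set
  Away j = j ≢ i₁ × j ≢ i₂

  away-below : ∀ {j} → j < p → Away j
  away-below j<p = ℕP.<⇒≢ (ℕP.m≤n⇒m≤n+o 0 j<p) , ℕP.<⇒≢ (ℕP.m≤n⇒m≤n+o 1 j<p)

  away-above : ∀ i → Away (p + suc (suc i))
  away-above i = ℕP.>⇒≢ (ℕP.+-monoʳ-< p z<s) , ℕP.>⇒≢ (ℕP.+-monoʳ-< p (s<s z<s))

  others : List ℕ
  others = upTo p ++ applyUpTo (λ i → p + suc (suc i)) q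

  away-others : All Away others
  away-others = AllP.++⁺ (AllP.applyUpTo⁺₁ id p away-below)
                         (AllP.applyUpTo⁺₂ (λ i → p + suc (suc i)) q away-above)

  before after : Fin n → List ℕ
  before k = blocks k id pre
  after  k = blocks k (λ i → p + suc (suc i)) post

  middle : Fin n → Entry n → Entry n → List ℕ
  middle k e e' = replicate (weight k e) i₁ ++ replicate (weight k e') i₂

  P-split : ∀ k e e' → P (pre ++ e ∷ e' ∷ post) k ≡ before k ++ middle k e e' ++ after k
  P-split k e e' = begin
    P (pre ++ e ∷ e' ∷ post) k
      ≡⟨ P≡blocks k (pre ++ e ∷ e' ∷ post) ⟩
    blocks k id (pre ++ e ∷ e' ∷ post)
      ≡⟨ blocks-++ k id pre (e ∷ e' ∷ post) ⟩
    before k ++ replicate (weight k e) i₁ ++ replicate (weight k e') i₂ ++ after k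
      ≡⟨ cong (before k ++_) (ListP.++-assoc (replicate (weight k e) i₁) _ (after k)) ⟨
    before k ++ middle k e e' ++ after k
      ∎
    where open ≡-Reasoning

  length-middle-swap : ∀ k e e' → length (middle k e e') ≡ length (middle k e' e)
  length-middle-swap k e e' = trans (length-middle e e') (trans (ℕP.+-comm (weight k e) _) (sym (length-middle e' e)))
    where
    length-middle : ∀ e e' → length (middle k e e') ≡ weight k e + weight k e'
    length-middle e e' = trans (ListP.length-++ (replicate (weight k e) i₁))
                               (cong₂ _+_ (ListP.length-replicate (weight k e)) (ListP.length-replicate (weight k e')))

  ω-prefix : Fin n → ℕ
  ω-prefix k = ∣ ω Λ k ∣

  c-split : ∀ j k → c Λ j k ≡ occ j (take (ω-prefix k) (before k ++ middle k e₁ e₂ ++ after k))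
  c-split j k = cong (occ j ∘ take (ω-prefix k)) (P-split k e₁ e₂)

  c'-split : ∀ j k → c Λ' j k ≡ occ j (take (ω-prefix k) (before k ++ middle k e₂ e₁ ++ after k))
  c'-split j k = cong₂ (λ m L → occ j (take m L)) (cong ∣_∣ (ω-swap pre e₂ e₁ post k)) (P-split k e₂ e₁)

  c-outside : ∀ {j} → Away j → cvec Λ j ≡ cvec Λ' j
  c-outside {j} (j≢i₁ , j≢i₂) = VecP.tabulate-cong λ k → begin
    c Λ j k
      ≡⟨ c-split j k ⟩
    occ j (take (ω-prefix k) (before k ++ middle k e₁ e₂ ++ after k))
      ≡⟨ occ-take-outside (ω-prefix k) (before k) (after k)
           (length-middle-swap k e₁ e₂) (middle-∌ k e₁ e₂) (middle-∌ k e₂ e₁) ⟩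
    occ j (take (ω-prefix k) (before k ++ middle k e₂ e₁ ++ after k))
      ≡⟨ c'-split j k ⟨
    c Λ' j k
      ∎
    where
    open ≡-Reasoning
    middle-∌ : ∀ k e e' → All (_≢ j) (middle k e e')
    middle-∌ k e e' = AllP.++⁺ (AllP.replicate⁺ (weight k e) (j≢i₁ ∘ sym)) (AllP.replicate⁺ (weight k e') (j≢i₂ ∘ sym))

  c-pair : ∀ k → c Λ i₁ k + c Λ i₂ k ≡ c Λ' i₁ k + c Λ' i₂ k
  c-pair k = begin
    c Λ i₁ k + c Λ i₂ k            ≡⟨ cong₂ _+_ (c-split i₁ k) (c-split i₂ k) ⟩
    _                              ≡⟨ pair-count e₁ e₂ ⟩
    t ⊓ length (middle k e₁ e₂)    ≡⟨ cong (t ⊓_) (length-middle-swap k e₁ e₂) ⟩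
    t ⊓ length (middle k e₂ e₁)    ≡⟨ pair-count e₂ e₁ ⟨
    _                              ≡⟨ cong₂ _+_ (c'-split i₁ k) (c'-split i₂ k) ⟨
    c Λ' i₁ k + c Λ' i₂ k          ∎
    where
    open ≡-Reasoning
    t = ω-prefix k ∸ length (before k)
    pair-count : ∀ e e' → occ i₁ (take (ω-prefix k) (before k ++ middle k e e' ++ after k))
                          + occ i₂ (take (ω-prefix k) (before k ++ middle k e e' ++ after k))
                        ≡ t ⊓ length (middle k e e')
    pair-count e e' = occ-take-pair (ℕP.<⇒≢ (ℕP.+-monoʳ-< p z<s)) (ω-prefix k)
      (blocks-labels k id pre away-below) (blocks-labels k (λ i → p + suc (suc i)) post λ {i} _ → away-above i)
      (AllP.++⁺ (AllP.replicate⁺ (weight k e) (inj₁ refl)) (AllP.replicate⁺ (weight k e') (inj₂ refl)))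

  sumPts-pair : sumPts (cvec Λ i₁ ∷ cvec Λ i₂ ∷ []) ≡ sumPts (cvec Λ' i₁ ∷ cvec Λ' i₂ ∷ [])
  sumPts-pair = begin
    sumPts (cvec Λ i₁ ∷ cvec Λ i₂ ∷ [])       ≡⟨ sumPts-tabulate-pair (c Λ i₁) (c Λ i₂) ⟩
    tabulate (λ k → c Λ i₁ k + c Λ i₂ k)      ≡⟨ VecP.tabulate-cong c-pair ⟩
    tabulate (λ k → c Λ' i₁ k + c Λ' i₂ k)    ≡⟨ sumPts-tabulate-pair (c Λ' i₁) (c Λ' i₂) ⟨
    sumPts (cvec Λ' i₁ ∷ cvec Λ' i₂ ∷ [])     ∎
    where open ≡-Reasoning

  ν-↭ : ∀ (L : List (Entry n)) → length L ≡ p + suc (suc q) → ν L ↭ map (cvec L) others ++ cvec L i₁ ∷ cvec L i₂ ∷ []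
  ν-↭ L |L| = begin
    map (cvec L) (upTo (length L))                     ≡⟨ cong (map (cvec L) ∘ upTo) |L| ⟩
    map (cvec L) (upTo (p + suc (suc q)))              ↭⟨ ↭P.map⁺ (cvec L) (upTo-↭ p q) ⟩
    map (cvec L) (others ++ i₁ ∷ i₂ ∷ [])              ≡⟨ ListP.map-++ (cvec L) others _ ⟩
    map (cvec L) others ++ cvec L i₁ ∷ cvec L i₂ ∷ []  ∎
    where open PermutationReasoning

  M : Monomial n
  M = map (cvec Λ) others

  ν-Λ-↭ : ν Λ ↭ M ++ cvec Λ i₁ ∷ cvec Λ i₂ ∷ []
  ν-Λ-↭ = ν-↭ Λ (ListP.length-++ pre {e₁ ∷ e₂ ∷ post})

  ν-Λ'-↭ : ν Λ' ↭ M ++ cvec Λ' i₁ ∷ cvec Λ' i₂ ∷ []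
  ν-Λ'-↭ = subst (λ M' → ν Λ' ↭ M' ++ cvec Λ' i₁ ∷ cvec Λ' i₂ ∷ []) M'≡M
                 (ν-↭ Λ' (ListP.length-++ pre {e₂ ∷ e₁ ∷ post}))
    where
    M'≡M : map (cvec Λ') others ≡ M
    M'≡M = sym (ListP.map-cong-local (All.map c-outside away-others))

-- c is defined through ∣ ω ∣ and the counting works for every prefix length.
lemma3p8 : ∀ {ℓc ℓ : Level} (K : Field ℓc ℓ) (n : ℕ) (A : Point n → Set)
    → AntiBlockingLatticePoints n A
    → (pre : List (Entry n)) (e₁ e₂ : Entry n) (post : List (Entry n))
    → let Λ = pre ++ e₁ ∷ e₂ ∷ post
          Λ' = pre ++ e₂ ∷ e₁ ∷ post
          open Poly K n
      in All (λ e → A (proj₁ e)) Λ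
      → (∀ k → + 0 ≤ ω Λ k)
      → Σ[ M ∈ Monomial n ] Σ[ c ∈ Point n ] Σ[ d ∈ Point n ] Σ[ c' ∈ Point n ] Σ[ d' ∈ Point n ]
          (All A M × A c × A d × A c' × A d'
           × InToric (binom c d c' d')
           × ((mono (ν Λ) −ₚ mono (ν Λ')) ≈ₚ (M ·ₘ binom c d c' d')))
lemma3p8 K n A ab pre e₁ e₂ post AΛ _ =
    M , cvec Λ i₁ , cvec Λ i₂ , cvec Λ' i₁ , cvec Λ' i₂
  , AllP.map⁺ (All.universal (cvec∈ ab AΛ) others)
  , cvec∈ ab AΛ i₁ , cvec∈ ab AΛ i₂ , cvec∈ ab AΛ' i₁ , cvec∈ ab AΛ' i₂
  , binom-toric K n sumPts-pair
  , −ₚ-≈ₚ-·ₘbinom K n ν-Λ-↭ ν-Λ'-↭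
  where
  open Swap pre e₁ e₂ post
  AΛ' : All (λ e → A (proj₁ e)) Λ'
  AΛ' = ↭P.All-resp-↭ (↭P.++⁺ˡ pre (↭.swap e₁ e₂ ↭.refl)) AΛ
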